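{- Let $\Gamma$ be a finite, simple, connected, bipartite, vertex-transitive graph of diameter at least $2$. Then $\Gamma$ is $2$-distance-balanced. In particular, every connected bipartite Cayley graph of diameter at least $2$ is $2$-distance-balanced.
   Context: The Cayley graph $\mathrm{Cay}(G;S)$ (with $S=S^{ -1}$, $1\notin S$) has vertex set $G$, with $g$ adjacent to $h$ whenever $g^{ -1}h \in S$. For vertices $u,v$, $W_{uv} = \{w \mid d(u,w) < d(v,w)\}$, where $d$ is the graph distance. A connected graph of diameter at least $2$ is $2$-distance-balanced if $|W_{uv}| = |W_{vu}|$ for all $u,v$ with $d(u,v)=2$. -}

module Defs where

open import Data.Nat using (ℕ; zero; suc; _<ᵇ_; _≤_)
open import Data.Fin using (Fin; zero; suc; _≟_)
open import Data.Bool using (Bool; true; false; _∧_; _∨_; if_then_else_; not)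
open import Data.Product using (Σ; ∃; _×_; _,_)
open import Relation.Nullary using (¬_)
open import Relation.Nullary.Decidable using (⌊_⌋)
open import Relation.Binary.PropositionalEquality using (_≡_; _≢_)
open import Function.Bundles using (_↔_; Inverse)
open import Algebra.Structures using (IsGroup)

Adj : ℕ → Set
Adj n = Fin n → Fin n → Bool

IsSimple : ∀ {n} → Adj n → Set
IsSimple {n} adj = (∀ (u v : Fin n) → adj u v ≡ adj v u) × (∀ (u : Fin n) → adj u u ≡ false)

anyFin : ∀ {n} → (Fin n → Bool) → Bool
anyFin {zero} p = false
anyFin {suc n} p = p zero ∨ anyFin (λ i → p (suc i))

count : ∀ {n} → (Fin n → Bool) → ℕ
count {zero} p = zero
count {suc n} p = (if p zero then 1 else 0) Data.Nat.+ count (λ i → p (suc i))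

data Walk {n} (adj : Adj n) : Fin n → Fin n → ℕ → Set where
  here : ∀ u → Walk adj u u zero
  step : ∀ {u v w k} → adj u v ≡ true → Walk adj v w k → Walk adj u w (suc k)

Connected : ∀ {n} → Adj n → Set
Connected {n} adj = ∀ (u v : Fin n) → ∃ λ k → Walk adj u v k

-- reach adj k u w = true iff there is a walk of length ≤ k from u to w.
reach : ∀ {n} → Adj n → ℕ → Fin n → Fin n → Bool
reach adj zero u w = ⌊ u ≟ w ⌋
reach adj (suc k) u w = reach adj k u w ∨ anyFin (λ x → reach adj k u x ∧ adj x w)

-- least k < b with p k, or b if none.
least : ℕ → (ℕ → Bool) → ℕ
least zero p = zero
least (suc b) p = if p zero then zero else suc (least b (λ k → p (suc k)))

-- Graph distance d(u,w): length of a shortest walk from u to w.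
-- (In a graph on n vertices any reachable vertex is at distance < n; the value n
--  is returned for unreachable vertices, which never occurs in a connected graph.)
dist : ∀ {n} → Adj n → Fin n → Fin n → ℕ
dist {n} adj u w = least n (λ k → reach adj k u w)

W : ∀ {n} → Adj n → Fin n → Fin n → ℕ
W adj u v = count (λ w → dist adj u w <ᵇ dist adj v w)

DiamAtLeast2 : ∀ {n} → Adj n → Set
DiamAtLeast2 {n} adj = Σ (Fin n) λ u → Σ (Fin n) λ v → 2 ≤ dist adj u v

Bipartite : ∀ {n} → Adj n → Set
Bipartite {n} adj = Σ (Fin n → Bool) λ c → ∀ (u v : Fin n) → adj u v ≡ true → c u ≢ c v

IsAutomorphism : ∀ {n} → Adj n → (Fin n ↔ Fin n) → Set
IsAutomorphism {n} adj σ = ∀ (x y : Fin n) → adj (Inverse.to σ x) (Inverse.to σ y) ≡ adj x y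

VertexTransitive : ∀ {n} → Adj n → Set
VertexTransitive {n} adj = ∀ (u v : Fin n) →
  Σ (Fin n ↔ Fin n) λ σ → IsAutomorphism adj σ × Inverse.to σ u ≡ v

TwoDistanceBalanced : ∀ {n} → Adj n → Set
TwoDistanceBalanced {n} adj = ∀ (u v : Fin n) → dist adj u v ≡ 2 → W adj u v ≡ W adj v u

-- Cayley graphs of a finite group whose carrier is Fin n (with _≡_ as equality).
-- S is given by its indicator function.
CayleyAdj : ∀ {n} → (Fin n → Fin n → Fin n) → (Fin n → Fin n) → (Fin n → Bool) → Adj n
CayleyAdj _∙_ _⁻¹ S g h = S ((g ⁻¹) ∙ h)

IsConnectionSet : ∀ {n} → (Fin n → Fin n) → Fin n → (Fin n → Bool) → Set
IsConnectionSet {n} _⁻¹ e S = (∀ (s : Fin n) → S (s ⁻¹) ≡ S s) × S e ≡ false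

-- If d(u,v) = 2 in a bipartite graph, u and v lie in the same colour class, so for every w the
-- distances d(u,w) and d(v,w) have the same parity and, by the triangle inequality, differ by at
-- most 2.  Hence d(u,w) + 2[d(u,w) < d(v,w)] = d(v,w) + 2[d(v,w) < d(u,w)], and summing over w
-- gives T(u) + 2|W_uv| = T(v) + 2|W_vu| for the transmission T(x) = Σ_w d(x,w).  Automorphisms
-- preserve T, so in a vertex-transitive graph |W_uv| = |W_vu|.  Cayley graphs are
-- vertex-transitive through left translations.
module Submission where

open import Defs
open import Data.Nat using (ℕ)
open import Data.Fin using (Fin)
open import Data.Bool using (Bool)
open import Data.Product using (_×_)
open import Relation.Binary.PropositionalEquality using (_≡_)
open import Algebra.Structures using (IsGroup)

open import Algebra.Bundles using (Group)
import Algebra.Properties.Group as GroupProperties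
open import Data.Bool using (true; false; not; _xor_; if_then_else_; T)
open import Data.Bool.Properties using (T-∨; T-∧; T-≡; ¬-not; not-injective; xor-same; not-distribˡ-xor)
open import Data.Empty using (⊥-elim)
open import Data.Fin using (zero; suc; toℕ)
open import Data.Fin.Properties using (pigeonhole)
open import Data.Nat using (zero; suc; _+_; _*_; _≤_; _<_; _<ᵇ_; _<?_; z≤n; s≤s)
open import Data.Nat.Induction using (<-wellFounded)
open import Data.Nat.Properties
  using (+-*-semiring; ≤-refl; ≤-antisym; ≮⇒≥; m≤n⇒m≤1+n; m<m+n; +-identityʳ; +-suc;
         +-cancelˡ-≡; *-cancelˡ-≡)
open import Data.Product using (∃; _,_)
open import Data.Sum using (inj₁; inj₂)
open import Function using (_∘_; Equivalence; mk↔ₛ′)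
open import Function.Bundles using (_↔_; Inverse)
open import Induction.WellFounded using (Acc; acc)
open import Relation.Nullary using (yes; no)
open import Relation.Nullary.Decidable using (fromWitness; toWitness)
open import Relation.Binary.PropositionalEquality
  using (refl; sym; trans; cong; cong₂; subst; subst₂; _≢_; module ≡-Reasoning)
open import Algebra.Properties.Semiring.Sum +-*-semiring
  using (sum; ∑-distrib-+; ∑-permute; sum-cong-≗; *-distribˡ-sum)

open Equivalence using (to; from)

odd : ℕ → Bool
odd zero    = false
odd (suc k) = not (odd k)

boolToℕ : Bool → ℕ
boolToℕ b = if b then 1 else 0

count≡sum : ∀ {m} (p : Fin m → Bool) → count p ≡ sum (boolToℕ ∘ p)
count≡sum {zero}  p = refl
count≡sum {suc m} p = cong (boolToℕ (p zero) +_) (count≡sum (p ∘ suc))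

count-balance : ∀ {m} (f g : Fin m → ℕ) (p q : Fin m → Bool) →
                (∀ i → f i + 2 * boolToℕ (p i) ≡ g i + 2 * boolToℕ (q i)) →
                sum f ≡ sum g → count p ≡ count q
count-balance f g p q pointwise Σf≡Σg = begin
  count p  ≡⟨ count≡sum p ⟩
  sum P    ≡⟨ *-cancelˡ-≡ (sum P) (sum Q) 2 (+-cancelˡ-≡ (sum f) _ _ totals) ⟩
  sum Q    ≡⟨ count≡sum q ⟨
  count q  ∎
  where
  open ≡-Reasoning
  P Q : Fin _ → ℕ
  P = boolToℕ ∘ p
  Q = boolToℕ ∘ q
  totals : sum f + 2 * sum P ≡ sum f + 2 * sum Q
  totals = begin
    sum f + 2 * sum P              ≡⟨ cong (sum f +_) (*-distribˡ-sum 2 P) ⟩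
    sum f + sum (λ i → 2 * P i)    ≡⟨ ∑-distrib-+ f _ ⟨
    sum (λ i → f i + 2 * P i)      ≡⟨ sum-cong-≗ pointwise ⟩
    sum (λ i → g i + 2 * Q i)      ≡⟨ ∑-distrib-+ g _ ⟩
    sum g + sum (λ i → 2 * Q i)    ≡⟨ cong₂ _+_ Σf≡Σg (*-distribˡ-sum 2 Q) ⟨
    sum f + 2 * sum Q              ∎

near-same-parity-balance : ∀ a b → odd a ≡ odd b → a ≤ 2 + b → b ≤ 2 + a →
                           a + 2 * boolToℕ (a <ᵇ b) ≡ b + 2 * boolToℕ (b <ᵇ a)
near-same-parity-balance zero                zero                _  _ _ = refl
near-same-parity-balance zero                (suc zero)          () _ _
near-same-parity-balance zero                (suc (suc zero))    _  _ _ = refl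
near-same-parity-balance zero                (suc (suc (suc _))) _  _ (s≤s (s≤s ()))
near-same-parity-balance (suc zero)          zero                () _ _
near-same-parity-balance (suc (suc zero))    zero                _  _ _ = refl
near-same-parity-balance (suc (suc (suc _))) zero                _  (s≤s (s≤s ())) _
near-same-parity-balance (suc a) (suc b) odd≡ (s≤s a≤) (s≤s b≤) =
  cong suc (near-same-parity-balance a b (not-injective odd≡) a≤ b≤)

anyFin-intro : ∀ {n} (p : Fin n → Bool) i → T (p i) → T (anyFin p)
anyFin-intro p zero    pᵢ = from T-∨ (inj₁ pᵢ)
anyFin-intro p (suc i) pᵢ = from (T-∨ {p zero}) (inj₂ (anyFin-intro (p ∘ suc) i pᵢ))

anyFin-witness : ∀ {n} (p : Fin n → Bool) → T (anyFin p) → ∃ λ i → T (p i)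
anyFin-witness {suc n} p any with to (T-∨ {p zero}) any
... | inj₁ p₀ = zero , p₀
... | inj₂ rest with anyFin-witness (p ∘ suc) rest
...   | i , pᵢ = suc i , pᵢ

least-minimal : ∀ b (p : ℕ → Bool) j → T (p j) → least b p ≤ j
least-minimal zero    p j       _  = z≤n
least-minimal (suc b) p j       pⱼ with p zero in p₀
... | true = z≤n
least-minimal (suc b) p zero    pⱼ | false = ⊥-elim (subst T p₀ pⱼ)
least-minimal (suc b) p (suc j) pⱼ | false = s≤s (least-minimal b (p ∘ suc) j pⱼ)

least-satisfies : ∀ b (p : ℕ → Bool) j → T (p j) → j < b → T (p (least b p))
least-satisfies (suc b) p j pⱼ j<b with p zero in p₀
... | true = subst T (sym p₀) _
least-satisfies (suc b) p zero    pⱼ _         | false = ⊥-elim (subst T p₀ pⱼ)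
least-satisfies (suc b) p (suc j) pⱼ (s≤s j<b) | false = least-satisfies b (p ∘ suc) j pⱼ j<b

module _ {n : ℕ} {adj : Adj n} where

  _∷ʳ_ : ∀ {u v w k} → Walk adj u v k → adj v w ≡ true → Walk adj u w (suc k)
  here _   ∷ʳ e = step e (here _)
  step e′ p ∷ʳ e = step e′ (p ∷ʳ e)

  unsnoc : ∀ {u w k} → Walk adj u w (suc k) → ∃ λ v → Walk adj u v k × adj v w ≡ true
  unsnoc (step e (here _))     = _ , here _ , e
  unsnoc (step e p@(step _ _)) with unsnoc p
  ... | v , q , e′ = v , step e q , e′

  _++_ : ∀ {u v w j k} → Walk adj u v j → Walk adj v w k → Walk adj u w (j + k)
  here _   ++ q = q
  step e p ++ q = step e (p ++ q)

  reverse : (∀ u v → adj u v ≡ adj v u) → ∀ {u w k} → Walk adj u w k → Walk adj w u k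
  reverse symmetric (here u)           = here u
  reverse symmetric (step {u} {v} e p) = reverse symmetric p ∷ʳ trans (symmetric v u) e

  map-walk : (f : Fin n → Fin n) → (∀ {x y} → adj x y ≡ true → adj (f x) (f y) ≡ true) →
             ∀ {u w k} → Walk adj u w k → Walk adj (f u) (f w) k
  map-walk f hom (here u)   = here (f u)
  map-walk f hom (step e p) = step (hom e) (map-walk f hom p)

  vertexAt : ∀ {u w k} → Walk adj u w k → Fin (suc k) → Fin n
  vertexAt {u} _ zero         = u
  vertexAt (step _ p) (suc i) = vertexAt p i

  suffix : ∀ {u w k} (p : Walk adj u w k) (i : Fin (suc k)) →
           ∃ λ m → Walk adj (vertexAt p i) w m × m + toℕ i ≡ k
  suffix {k = k} p zero = k , p , +-identityʳ k
  suffix (step _ p) (suc i) with suffix p i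
  ... | m , q , m+i≡k = m , q , trans (+-suc m (toℕ i)) (cong suc m+i≡k)

  shortcut : ∀ {u w k} (p : Walk adj u w k) (i j : Fin (suc k)) → toℕ i < toℕ j →
             vertexAt p i ≡ vertexAt p j → ∃ λ m → m < k × Walk adj u w m
  shortcut p zero j 0<j repeated with suffix p j
  ... | m , q , m+j≡k = m , subst (m <_) m+j≡k (m<m+n m 0<j) , subst (λ x → Walk adj x _ m) (sym repeated) q
  shortcut (step e p) (suc i) (suc j) (s≤s i<j) repeated with shortcut p i j i<j repeated
  ... | m , m<k , q = suc m , s≤s m<k , step e q

  shorten : ∀ {u w k} → Acc _<_ k → Walk adj u w k → ∃ λ m → m < n × Walk adj u w m
  shorten {k = k} (acc smaller) p with k <? n
  ... | yes k<n = k , k<n , p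
  ... | no k≮n with pigeonhole (s≤s (≮⇒≥ k≮n)) (vertexAt p)
  ...   | i , j , i<j , repeated with shortcut p i j i<j repeated
  ...     | m , m<k , q = shorten (smaller m<k) q

  reach-complete : ∀ {u w j} k → Walk adj u w j → j ≤ k → T (reach adj k u w)
  reach-complete zero    (here _)     z≤n       = fromWitness refl
  reach-complete (suc k) (here _)     z≤n       = from T-∨ (inj₁ (reach-complete k (here _) z≤n))
  reach-complete (suc k) p@(step _ _) (s≤s j≤k) with unsnoc p
  ... | v , q , e = from T-∨ (inj₂ (anyFin-intro _ v (from T-∧ (reach-complete k q j≤k , from T-≡ e))))

  reach-sound : ∀ {u w} k → T (reach adj k u w) → ∃ λ j → j ≤ k × Walk adj u w j
  reach-sound zero r with toWitness r
  ... | refl = zero , z≤n , here _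
  reach-sound {u} {w} (suc k) r with to (T-∨ {reach adj k u w}) r
  ... | inj₁ r′ with reach-sound k r′
  ...   | j , j≤k , p = j , m≤n⇒m≤1+n j≤k , p
  reach-sound {u} {w} (suc k) r | inj₂ r′ with anyFin-witness _ r′
  ... | v , r″ with to (T-∧ {reach adj k u v}) r″
  ...   | rᵥ , e with reach-sound k rᵥ
  ...     | j , j≤k , p = suc j , s≤s j≤k , p ∷ʳ to T-≡ e

  dist-minimal : ∀ {u w j} → Walk adj u w j → dist adj u w ≤ j
  dist-minimal {u} {w} {j} p = least-minimal n (λ k → reach adj k u w) j (reach-complete j p ≤-refl)

  module _ (connected : Connected adj) where

    shortestWalk : ∀ u w → Walk adj u w (dist adj u w)
    shortestWalk u w with connected u w
    ... | k , p with shorten (<-wellFounded k) p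
    ...   | m , m<n , q
      with reach-sound (dist adj u w)
             (least-satisfies n (λ k → reach adj k u w) m (reach-complete m q ≤-refl) m<n)
    ...     | j , j≤d , r = subst (Walk adj u w) (≤-antisym j≤d (dist-minimal r)) r

    dist-triangle : ∀ u v w → dist adj u w ≤ dist adj u v + dist adj v w
    dist-triangle u v w = dist-minimal (shortestWalk u v ++ shortestWalk v w)

    dist-sym : (∀ u v → adj u v ≡ adj v u) → ∀ u v → dist adj u v ≡ dist adj v u
    dist-sym symmetric u v =
      ≤-antisym (dist-minimal (reverse symmetric (shortestWalk v u)))
                (dist-minimal (reverse symmetric (shortestWalk u v)))

    dist-homomorphism-≤ : (f : Fin n → Fin n) → (∀ {x y} → adj x y ≡ true → adj (f x) (f y) ≡ true) →
                          ∀ u w → dist adj (f u) (f w) ≤ dist adj u w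
    dist-homomorphism-≤ f hom u w = dist-minimal (map-walk f hom (shortestWalk u w))

    dist-automorphism : (σ : Fin n ↔ Fin n) → IsAutomorphism adj σ →
                        ∀ u w → dist adj (Inverse.to σ u) (Inverse.to σ w) ≡ dist adj u w
    dist-automorphism σ aut u w = ≤-antisym
      (dist-homomorphism-≤ σ→ (λ {x} {y} e → trans (aut x y) e) u w)
      (subst₂ (λ x y → dist adj x y ≤ _) (strictlyInverseʳ u) (strictlyInverseʳ w)
        (dist-homomorphism-≤ σ← (λ {x} {y} e → trans (sym (σ←-aut x y)) e) (σ→ u) (σ→ w)))
      where
      open Inverse σ using (strictlyInverseˡ; strictlyInverseʳ) renaming (to to σ→; from to σ←)
      σ←-aut : ∀ x y → adj x y ≡ adj (σ← x) (σ← y)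
      σ←-aut x y = trans (cong₂ adj (sym (strictlyInverseˡ x)) (sym (strictlyInverseˡ y)))
                         (aut (σ← x) (σ← y))

    transmission-automorphism : (σ : Fin n ↔ Fin n) → IsAutomorphism adj σ →
                                ∀ u → sum (dist adj (Inverse.to σ u)) ≡ sum (dist adj u)
    transmission-automorphism σ aut u =
      trans (∑-permute (dist adj (Inverse.to σ u)) σ) (sum-cong-≗ (dist-automorphism σ aut u))

    odd-dist : (c : Fin n → Bool) → (∀ u v → adj u v ≡ true → c u ≢ c v) →
               ∀ u w → odd (dist adj u w) ≡ c u xor c w
    odd-dist c proper u w = odd-length (shortestWalk u w)
      where
      open ≡-Reasoning
      odd-length : ∀ {u w k} → Walk adj u w k → odd k ≡ c u xor c w
      odd-length (here u) = sym (xor-same (c u))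
      odd-length (step {u} {v} {w} {k} e p) = begin
        not (odd k)        ≡⟨ cong not (odd-length p) ⟩
        not (c v xor c w)  ≡⟨ not-distribˡ-xor (c v) (c w) ⟩
        not (c v) xor c w  ≡⟨ cong (_xor c w) (¬-not (proper u v e)) ⟨
        c u xor c w        ∎

xor≡false⇒≡ : ∀ {x y} → x xor y ≡ false → x ≡ y
xor≡false⇒≡ {false} {false} _ = refl
xor≡false⇒≡ {true}  {true}  _ = refl

bipartite-vertexTransitive⇒twoDistanceBalanced :
  ∀ {n} (adj : Adj n) → (∀ u v → adj u v ≡ adj v u) → Connected adj → Bipartite adj →
  VertexTransitive adj → TwoDistanceBalanced adj
bipartite-vertexTransitive⇒twoDistanceBalanced adj symmetric connected (c , proper) transitive u v d≡2 =
  count-balance (dist adj u) (dist adj v) _ _ balanced equal-transmission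
  where
  same-colour : c u ≡ c v
  same-colour = xor≡false⇒≡ (trans (sym (odd-dist connected c proper u v)) (cong odd d≡2))

  balanced : ∀ w → dist adj u w + 2 * boolToℕ (dist adj u w <ᵇ dist adj v w)
                 ≡ dist adj v w + 2 * boolToℕ (dist adj v w <ᵇ dist adj u w)
  balanced w = near-same-parity-balance (dist adj u w) (dist adj v w)
    (trans (odd-dist connected c proper u w)
      (trans (cong (_xor c w) same-colour) (sym (odd-dist connected c proper v w))))
    (subst (λ d → dist adj u w ≤ d + dist adj v w) d≡2 (dist-triangle connected u v w))
    (subst (λ d → dist adj v w ≤ d + dist adj u w) (trans (dist-sym connected symmetric v u) d≡2)
      (dist-triangle connected v u w))

  equal-transmission : sum (dist adj u) ≡ sum (dist adj v)
  equal-transmission with transitive u v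
  ... | σ , aut , σu≡v =
    trans (sym (transmission-automorphism connected σ aut u)) (cong (sum ∘ dist adj) σu≡v)

module _ {n : ℕ} {_∙_ : Fin n → Fin n → Fin n} {e : Fin n} {_⁻¹ : Fin n → Fin n}
         (isGroup : IsGroup _≡_ _∙_ e _⁻¹) (S : Fin n → Bool) where

  private
    group : Group _ _
    group = record { isGroup = isGroup }
  open IsGroup isGroup using (assoc; identityʳ; inverseˡ; _\\_)
  open GroupProperties group using (⁻¹-anti-homo-∙; ⁻¹-involutive; \\-leftDividesˡ; \\-leftDividesʳ)
  open ≡-Reasoning

  cayley-symmetric : (∀ s → S (s ⁻¹) ≡ S s) → ∀ g h → CayleyAdj _∙_ _⁻¹ S g h ≡ CayleyAdj _∙_ _⁻¹ S h g
  cayley-symmetric S⁻¹≡S g h = begin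
    S ((g ⁻¹) ∙ h)            ≡⟨ S⁻¹≡S _ ⟨
    S (((g ⁻¹) ∙ h) ⁻¹)       ≡⟨ cong S (⁻¹-anti-homo-∙ (g ⁻¹) h) ⟩
    S ((h ⁻¹) ∙ ((g ⁻¹) ⁻¹))  ≡⟨ cong (λ x → S ((h ⁻¹) ∙ x)) (⁻¹-involutive g) ⟩
    S ((h ⁻¹) ∙ g)            ∎

  leftTranslation : Fin n → Fin n ↔ Fin n
  leftTranslation a = mk↔ₛ′ (a ∙_) (a \\_) (\\-leftDividesˡ a) (\\-leftDividesʳ a)

  leftTranslation-isAutomorphism : ∀ a → IsAutomorphism (CayleyAdj _∙_ _⁻¹ S) (leftTranslation a)
  leftTranslation-isAutomorphism a x y = cong S (begin
    ((a ∙ x) ⁻¹) ∙ (a ∙ y)       ≡⟨ cong (_∙ (a ∙ y)) (⁻¹-anti-homo-∙ a x) ⟩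
    ((x ⁻¹) ∙ (a ⁻¹)) ∙ (a ∙ y)  ≡⟨ assoc _ _ _ ⟩
    (x ⁻¹) ∙ (a \\ (a ∙ y))      ≡⟨ cong ((x ⁻¹) ∙_) (\\-leftDividesʳ a y) ⟩
    (x ⁻¹) ∙ y                   ∎)

  cayley-vertexTransitive : VertexTransitive (CayleyAdj _∙_ _⁻¹ S)
  cayley-vertexTransitive u v =
    leftTranslation (v ∙ (u ⁻¹)) , leftTranslation-isAutomorphism (v ∙ (u ⁻¹)) ,
    trans (assoc v (u ⁻¹) u) (trans (cong (v ∙_) (inverseˡ u)) (identityʳ v))

corollary2p7 :
    ((n : ℕ) (adj : Adj n) → IsSimple adj → Connected adj → Bipartite adj →
      VertexTransitive adj → DiamAtLeast2 adj → TwoDistanceBalanced adj)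
    ×
    ((n : ℕ) (_∙_ : Fin n → Fin n → Fin n) (e : Fin n) (_⁻¹ : Fin n → Fin n) →
      IsGroup _≡_ _∙_ e _⁻¹ → (S : Fin n → Bool) → IsConnectionSet _⁻¹ e S →
      Connected (CayleyAdj _∙_ _⁻¹ S) → Bipartite (CayleyAdj _∙_ _⁻¹ S) →
      DiamAtLeast2 (CayleyAdj _∙_ _⁻¹ S) → TwoDistanceBalanced (CayleyAdj _∙_ _⁻¹ S))
corollary2p7 =
    (λ _ adj (symmetric , _) connected bipartite transitive _ →
      bipartite-vertexTransitive⇒twoDistanceBalanced adj symmetric connected bipartite transitive)
  , (λ _ _∙_ _ _⁻¹ isGroup S (S⁻¹≡S , _) connected bipartite _ →
      bipartite-vertexTransitive⇒twoDistanceBalanced (CayleyAdj _∙_ _⁻¹ S)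
        (cayley-symmetric isGroup S S⁻¹≡S) connected bipartite (cayley-vertexTransitive isGroup S))
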